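{- Suppose $\vdash_{S_1^- } f:\gamma_1\to\gamma_0$. (a) For $X\in\{TD,DP\}$ and every environment $\theta$ assigning a type-$\gamma_1$ value to $x_1$: $\mathrm{size}(\text{value of }(f\,x_1)\theta)\le \mathrm{size}(\theta(x_1))+\mathrm{cost}_X((f\,x_1)\theta)$. (b) If $f$ is TD-poly-cost then $f$ is DP-poly-cost. (c) If $f$ is DP-poly-cost and every $\mathsf{fold}_{\mu P}$-expression within $f$ has $\mu P$ sequential, then $f$ is TD-poly-cost.
   Context: $S_1^-$ is a first-order call-by-value typed $\lambda$-calculus with ground types built from $\mathsf{unit}$ and inductive data types $\mu P$ ($P$ a polynomial functor built from $\mathrm{Id}$, constant functors $\mathsf C_N$, $+,\times$; $\mu P$ its nonempty least fixed point) using $+,\times$; terms: variables, $\lambda x.e$, application, $()$, pairs/projections, injections/case, constructors $\mathsf{c}_{\mu P}:P(\mu P)\to\mu P$, destructors $\mathsf d_{\mu P}$, and $\mathsf{fold}_{\mu P} f\,e$ with $(\mathsf{fold} f)\circ\mathsf c=f\circ P(\mathsf{fold} f)$. A ground type is sequential iff it is $\mathsf{unit}$, or a sum or product of sequential types, or $\mu P$ with $P$ of degree at most one. Values are rooted labelled dags (vertices $\underline{()}$, $\underline\iota_j$, pair, $\underline{\mathsf c}_{\mu P}$) with sharing; $\mathrm{size}(v)$ = number of $\underline{\mathsf c}_{\mu P}$ vertices. Top-down (TD) semantics: big-step call-by-value evaluation of closures $e\theta$, where each constructor application creates one fresh vertex and $\mathsf{fold}_{\mu P} f\,e$ evaluates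 as $f(P(\mathsf{fold} f)(\mathsf d e))$, ignoring sharing. Dynamic-programming (DP) semantics: the same except folds are evaluated bottom-up over the dag of the argument with the result memoized at each vertex. $\mathrm{cost}_X(e\theta)$ is the number of nodes of the derivation tree of $e\theta$ under semantics $X$; $f$ is $X$-poly-cost iff there is a polynomial $q$ with $\mathrm{cost}_X((f\,x_1)\theta)\le q(\mathrm{size}(\theta(x_1)))$ for all $\theta$. -}

module Defs where

open import Data.Nat using (ℕ; zero; suc; _+_; _*_; _≤_; _<_; _≡ᵇ_; _⊔_)
open import Data.Bool using (Bool; true; false; if_then_else_; _∨_)
open import Data.List using (List; []; _∷_; length; _++_)
open import Data.List.Relation.Unary.All using (All)
open import Data.Maybe using (Maybe; just; nothing)
open import Data.Product using (Σ; _×_; _,_)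
open import Data.Sum using (_⊎_)
open import Data.Unit using (⊤)
open import Data.Empty using (⊥)
open import Relation.Binary.PropositionalEquality using (_≡_)

infixr 5 _⊕_ _⊞_
infixr 6 _⊗_ _⊠_

data Ty : Set
data Poly : Set

data Ty where
  unit : Ty
  _⊕_  : Ty → Ty → Ty
  _⊗_  : Ty → Ty → Ty
  μ    : Poly → Ty

data Poly where
  Id  : Poly
  K   : Ty → Poly
  _⊞_ : Poly → Poly → Poly
  _⊠_ : Poly → Poly → Poly

_⟪_⟫ : Poly → Ty → Ty
Id ⟪ τ ⟫      = τ
K σ ⟪ τ ⟫     = σ
(P ⊞ Q) ⟪ τ ⟫ = P ⟪ τ ⟫ ⊕ Q ⟪ τ ⟫
(P ⊠ Q) ⟪ τ ⟫ = P ⟪ τ ⟫ ⊗ Q ⟪ τ ⟫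

deg : Poly → ℕ
deg Id      = 1
deg (K _)   = 0
deg (P ⊞ Q) = deg P ⊔ deg Q
deg (P ⊠ Q) = deg P + deg Q

InhT : Ty → Set
InhP : Poly → Set
InhT unit    = ⊤
InhT (a ⊕ b) = InhT a ⊎ InhT b
InhT (a ⊗ b) = InhT a × InhT b
InhT (μ P)   = InhP P
InhP Id      = ⊥                 -- least fixed point: Id contributes nothing
InhP (K σ)   = InhT σ
InhP (P ⊞ Q) = InhP P ⊎ InhP Q
InhP (P ⊠ Q) = InhP P × InhP Q

WFT : Ty → Set
WFP : Poly → Set
WFT unit    = ⊤
WFT (a ⊕ b) = WFT a × WFT b
WFT (a ⊗ b) = WFT a × WFT b
WFT (μ P)   = WFP P × InhP P
WFP Id      = ⊤
WFP (K σ)   = WFT σ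
WFP (P ⊞ Q) = WFP P × WFP Q
WFP (P ⊠ Q) = WFP P × WFP Q

Seq : Ty → Set
Seq unit    = ⊤
Seq (a ⊕ b) = Seq a × Seq b
Seq (a ⊗ b) = Seq a × Seq b
Seq (μ P)   = deg P ≤ 1

Ctx : Set
Ctx = List Ty

data Var : Ctx → Ty → Set where
  here  : ∀ {Γ τ} → Var (τ ∷ Γ) τ
  there : ∀ {Γ σ τ} → Var Γ τ → Var (σ ∷ Γ) τ

data Tm (Γ : Ctx) : Ty → Set
data Fn (Γ : Ctx) : Ty → Ty → Set

data Tm Γ where
  var  : ∀ {τ} → Var Γ τ → Tm Γ τ
  tt   : Tm Γ unit
  pair : ∀ {σ τ} → Tm Γ σ → Tm Γ τ → Tm Γ (σ ⊗ τ)
  fst  : ∀ {σ τ} → Tm Γ (σ ⊗ τ) → Tm Γ σ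
  snd  : ∀ {σ τ} → Tm Γ (σ ⊗ τ) → Tm Γ τ
  inl  : ∀ {σ τ} → Tm Γ σ → Tm Γ (σ ⊕ τ)
  inr  : ∀ {σ τ} → Tm Γ τ → Tm Γ (σ ⊕ τ)
  case : ∀ {σ τ ρ} → Tm Γ (σ ⊕ τ) → Tm (σ ∷ Γ) ρ → Tm (τ ∷ Γ) ρ → Tm Γ ρ
  con  : (P : Poly) → Tm Γ (P ⟪ μ P ⟫) → Tm Γ (μ P)
  des  : (P : Poly) → Tm Γ (μ P) → Tm Γ (P ⟪ μ P ⟫)
  app  : ∀ {σ τ} → Fn Γ σ τ → Tm Γ σ → Tm Γ τ
  fold : ∀ {τ} (P : Poly) → Fn Γ (P ⟪ τ ⟫) τ → Tm Γ (μ P) → Tm Γ τ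

data Fn Γ where
  lam : ∀ {σ τ} → Tm (σ ∷ Γ) τ → Fn Γ σ τ

Ren : Ctx → Ctx → Set
Ren Γ Δ = ∀ {τ} → Var Γ τ → Var Δ τ

ext : ∀ {Γ Δ σ} → Ren Γ Δ → Ren (σ ∷ Γ) (σ ∷ Δ)
ext r here      = here
ext r (there x) = there (r x)

ren  : ∀ {Γ Δ τ} → Ren Γ Δ → Tm Γ τ → Tm Δ τ
renF : ∀ {Γ Δ σ τ} → Ren Γ Δ → Fn Γ σ τ → Fn Δ σ τ
ren r (var x)        = var (r x)
ren r tt             = tt
ren r (pair a b)     = pair (ren r a) (ren r b)
ren r (fst e)        = fst (ren r e)
ren r (snd e)        = snd (ren r e)
ren r (inl e)        = inl (ren r e)
ren r (inr e)        = inr (ren r e)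
ren r (case e e₁ e₂) = case (ren r e) (ren (ext r) e₁) (ren (ext r) e₂)
ren r (con P e)      = con P (ren r e)
ren r (des P e)      = des P (ren r e)
ren r (app F e)      = app (renF r F) (ren r e)
ren r (fold P F e)   = fold P (renF r F) (ren r e)
renF r (lam e)       = lam (ren (ext r) e)

wfTm  : ∀ {Γ τ} → Tm Γ τ → Set
wfSub : ∀ {Γ τ} → Tm Γ τ → Set
wfFn  : ∀ {Γ σ τ} → Fn Γ σ τ → Set
wfTm {τ = τ} t = WFT τ × wfSub t
wfSub (var x)        = ⊤
wfSub tt             = ⊤
wfSub (pair a b)     = wfTm a × wfTm b
wfSub (fst e)        = wfTm e
wfSub (snd e)        = wfTm e
wfSub (inl e)        = wfTm e
wfSub (inr e)        = wfTm e
wfSub (case e e₁ e₂) = wfTm e × wfTm e₁ × wfTm e₂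
wfSub (con P e)      = wfTm e
wfSub (des P e)      = wfTm e
wfSub (app F e)      = wfFn F × wfTm e
wfSub (fold P F e)   = wfFn F × wfTm e
wfFn (lam {σ} {τ} e) = WFT σ × WFT τ × wfTm e

seqFolds  : ∀ {Γ τ} → Tm Γ τ → Set
seqFoldsF : ∀ {Γ σ τ} → Fn Γ σ τ → Set
seqFolds (var x)        = ⊤
seqFolds tt             = ⊤
seqFolds (pair a b)     = seqFolds a × seqFolds b
seqFolds (fst e)        = seqFolds e
seqFolds (snd e)        = seqFolds e
seqFolds (inl e)        = seqFolds e
seqFolds (inr e)        = seqFolds e
seqFolds (case e e₁ e₂) = seqFolds e × seqFolds e₁ × seqFolds e₂
seqFolds (con P e)      = seqFolds e
seqFolds (des P e)      = seqFolds e
seqFolds (app F e)      = seqFoldsF F × seqFolds e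
seqFolds (fold P F e)   = Seq (μ P) × seqFoldsF F × seqFolds e
seqFoldsF (lam e)       = seqFolds e

-- Values: rooted labelled dags with sharing, represented inside a heap.
-- A heap is a list of vertices, newest first; the vertex at the head of
-- (nd ∷ h) has address  length h.  A value is an address in a heap.

data Node : Set where
  unitN : Node
  injN  : Bool → ℕ → Node        -- ι_1 (false) / ι_2 (true)
  pairN : ℕ → ℕ → Node
  conN  : Poly → ℕ → Node

Heap : Set
Heap = List Node

lookupH : Heap → ℕ → Maybe Node
lookupH []       i = nothing
lookupH (n ∷ h)  i = if i ≡ᵇ length h then just n else lookupH h i

children : Node → List ℕ
children unitN       = []
children (injN _ p)  = p ∷ []
children (pairN p q) = p ∷ q ∷ []
children (conN _ p)  = p ∷ []

-- dag condition: edges point to older vertices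
WFHeap : Heap → Set
WFHeap []      = ⊤
WFHeap (n ∷ h) = All (_< length h) (children n) × WFHeap h

data HasTy (h : Heap) : ℕ → Ty → Set where
  ty-unit : ∀ {p} → lookupH h p ≡ just unitN → HasTy h p unit
  ty-inl  : ∀ {p q σ τ} → lookupH h p ≡ just (injN false q) → HasTy h q σ → HasTy h p (σ ⊕ τ)
  ty-inr  : ∀ {p q σ τ} → lookupH h p ≡ just (injN true q) → HasTy h q τ → HasTy h p (σ ⊕ τ)
  ty-pair : ∀ {p a b σ τ} → lookupH h p ≡ just (pairN a b) → HasTy h a σ → HasTy h b τ → HasTy h p (σ ⊗ τ)
  ty-con  : ∀ {p q P} → lookupH h p ≡ just (conN P q) → HasTy h q (P ⟪ μ P ⟫) → HasTy h p (μ P)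

-- size: number of c-vertices of the dag rooted at p (reachable from p)
mem : ℕ → List ℕ → Bool
mem i []       = false
mem i (j ∷ js) = (i ≡ᵇ j) ∨ mem i js

isCon : Node → ℕ
isCon (conN _ _) = 1
isCon _          = 0

sizeM : List ℕ → Heap → ℕ
sizeM ms []      = 0
sizeM ms (n ∷ h) = if mem (length h) ms
                   then isCon n + sizeM (children n ++ ms) h
                   else sizeM ms h

size : Heap → ℕ → ℕ
size h p = sizeM (p ∷ []) h

-- Big-step semantics; the last index of each judgement is the number of
-- nodes of the derivation tree (each rule contributes one node).

data Mode : Set where
  TD DP : Mode

data Env : Ctx → Set where
  []  : Env []
  _∷_ : ∀ {Γ τ} → ℕ → Env Γ → Env (τ ∷ Γ)

lookupE : ∀ {Γ τ} → Env Γ → Var Γ τ → ℕ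
lookupE (p ∷ ρ) here      = p
lookupE (p ∷ ρ) (there x) = lookupE ρ x

Memo : Set
Memo = List (ℕ × ℕ)

lookupM : Memo → ℕ → Maybe ℕ
lookupM []            i = nothing
lookupM ((j , r) ∷ m) i = if i ≡ᵇ j then just r else lookupM m i

data Eval  : Mode → ∀ {Γ τ} → Env Γ → Heap → Tm Γ τ → ℕ → Heap → ℕ → Set
data Apply : Mode → ∀ {Γ σ τ} → Env Γ → Heap → Fn Γ σ τ → ℕ → ℕ → Heap → ℕ → Set
-- top-down fold: fold f e  ~>  f (P(fold f) (d e))
data FoldTD : ∀ {Γ τ} → Env Γ → Heap → (P : Poly) → Fn Γ (P ⟪ τ ⟫) τ → ℕ → ℕ → Heap → ℕ → Set
-- MapTD ... P F Q q q' : action of the sub-functor Q of P on (fold F)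
data MapTD  : ∀ {Γ τ} → Env Γ → Heap → (P : Poly) → Fn Γ (P ⟪ τ ⟫) τ → Poly → ℕ → ℕ → Heap → ℕ → Set
-- dynamic-programming fold: memoised at each vertex of the argument dag
data FoldDP : ∀ {Γ τ} → Env Γ → Memo → Heap → (P : Poly) → Fn Γ (P ⟪ τ ⟫) τ → ℕ → ℕ → Memo → Heap → ℕ → Set
data MapDP  : ∀ {Γ τ} → Env Γ → Memo → Heap → (P : Poly) → Fn Γ (P ⟪ τ ⟫) τ → Poly → ℕ → ℕ → Memo → Heap → ℕ → Set

data Eval where
  ev-var  : ∀ {X Γ τ ρ h} {x : Var Γ τ} → Eval X ρ h (var x) (lookupE ρ x) h 1
  ev-tt   : ∀ {X Γ ρ h} → Eval X {Γ} ρ h tt (length h) (unitN ∷ h) 1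
  ev-pair : ∀ {X Γ σ τ ρ h h₁ h₂ p₁ p₂ c₁ c₂} {a : Tm Γ σ} {b : Tm Γ τ} →
            Eval X ρ h a p₁ h₁ c₁ → Eval X ρ h₁ b p₂ h₂ c₂ →
            Eval X ρ h (pair a b) (length h₂) (pairN p₁ p₂ ∷ h₂) (suc (c₁ + c₂))
  ev-fst  : ∀ {X Γ σ τ ρ h h₁ p q q' c} {e : Tm Γ (σ ⊗ τ)} →
            Eval X ρ h e p h₁ c → lookupH h₁ p ≡ just (pairN q q') →
            Eval X ρ h (fst e) q h₁ (suc c)
  ev-snd  : ∀ {X Γ σ τ ρ h h₁ p q q' c} {e : Tm Γ (σ ⊗ τ)} →
            Eval X ρ h e p h₁ c → lookupH h₁ p ≡ just (pairN q q') →
            Eval X ρ h (snd e) q' h₁ (suc c)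
  ev-inl  : ∀ {X Γ σ τ ρ h h₁ p c} {e : Tm Γ σ} →
            Eval X ρ h e p h₁ c →
            Eval X ρ h (inl {τ = τ} e) (length h₁) (injN false p ∷ h₁) (suc c)
  ev-inr  : ∀ {X Γ σ τ ρ h h₁ p c} {e : Tm Γ τ} →
            Eval X ρ h e p h₁ c →
            Eval X ρ h (inr {σ = σ} e) (length h₁) (injN true p ∷ h₁) (suc c)
  ev-case₁ : ∀ {X Γ σ τ υ ρ h h₁ h₂ p q r c c₁} {e : Tm Γ (σ ⊕ τ)}
               {e₁ : Tm (σ ∷ Γ) υ} {e₂ : Tm (τ ∷ Γ) υ} →
             Eval X ρ h e p h₁ c → lookupH h₁ p ≡ just (injN false q) →
             Eval X (q ∷ ρ) h₁ e₁ r h₂ c₁ →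
             Eval X ρ h (case e e₁ e₂) r h₂ (suc (c + c₁))
  ev-case₂ : ∀ {X Γ σ τ υ ρ h h₁ h₂ p q r c c₂} {e : Tm Γ (σ ⊕ τ)}
               {e₁ : Tm (σ ∷ Γ) υ} {e₂ : Tm (τ ∷ Γ) υ} →
             Eval X ρ h e p h₁ c → lookupH h₁ p ≡ just (injN true q) →
             Eval X (q ∷ ρ) h₁ e₂ r h₂ c₂ →
             Eval X ρ h (case e e₁ e₂) r h₂ (suc (c + c₂))
  ev-con  : ∀ {X Γ P ρ h h₁ p c} {e : Tm Γ (P ⟪ μ P ⟫)} →
            Eval X ρ h e p h₁ c →
            Eval X ρ h (con P e) (length h₁) (conN P p ∷ h₁) (suc c)
  ev-des  : ∀ {X Γ P ρ h h₁ p q c} {e : Tm Γ (μ P)} →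
            Eval X ρ h e p h₁ c → lookupH h₁ p ≡ just (conN P q) →
            Eval X ρ h (des P e) q h₁ (suc c)
  ev-app  : ∀ {X Γ σ τ ρ h h₁ h₂ p r c c'} {F : Fn Γ σ τ} {e : Tm Γ σ} →
            Eval X ρ h e p h₁ c → Apply X ρ h₁ F p r h₂ c' →
            Eval X ρ h (app F e) r h₂ (suc (c + c'))
  ev-foldTD : ∀ {Γ τ P ρ h h₁ h₂ p r c c'} {F : Fn Γ (P ⟪ τ ⟫) τ} {e : Tm Γ (μ P)} →
              Eval TD ρ h e p h₁ c → FoldTD ρ h₁ P F p r h₂ c' →
              Eval TD ρ h (fold P F e) r h₂ (suc (c + c'))
  ev-foldDP : ∀ {Γ τ P ρ h h₁ h₂ p r c c' m} {F : Fn Γ (P ⟪ τ ⟫) τ} {e : Tm Γ (μ P)} →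
              Eval DP ρ h e p h₁ c → FoldDP ρ [] h₁ P F p r m h₂ c' →
              Eval DP ρ h (fold P F e) r h₂ (suc (c + c'))

data Apply where
  ap-lam : ∀ {X Γ σ τ ρ h h₁ p r c} {e : Tm (σ ∷ Γ) τ} →
           Eval X (p ∷ ρ) h e r h₁ c → Apply X ρ h (lam e) p r h₁ (suc c)

data FoldTD where
  fd : ∀ {Γ τ ρ h h₁ h₂ P p q q' r c₁ c₂} {F : Fn Γ (P ⟪ τ ⟫) τ} →
       lookupH h p ≡ just (conN P q) →
       MapTD ρ h P F P q q' h₁ c₁ → Apply TD ρ h₁ F q' r h₂ c₂ →
       FoldTD ρ h P F p r h₂ (suc (c₁ + c₂))

data MapTD where
  mp-id : ∀ {Γ τ ρ h h₁ P q r c} {F : Fn Γ (P ⟪ τ ⟫) τ} →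
          FoldTD ρ h P F q r h₁ c → MapTD ρ h P F Id q r h₁ (suc c)
  mp-k  : ∀ {Γ τ ρ h P σ q} {F : Fn Γ (P ⟪ τ ⟫) τ} →
          MapTD ρ h P F (K σ) q q h 1
  mp-inl : ∀ {Γ τ ρ h h₁ P Q₁ Q₂ q q₀ q₁ c} {F : Fn Γ (P ⟪ τ ⟫) τ} →
           lookupH h q ≡ just (injN false q₀) → MapTD ρ h P F Q₁ q₀ q₁ h₁ c →
           MapTD ρ h P F (Q₁ ⊞ Q₂) q (length h₁) (injN false q₁ ∷ h₁) (suc c)
  mp-inr : ∀ {Γ τ ρ h h₁ P Q₁ Q₂ q q₀ q₁ c} {F : Fn Γ (P ⟪ τ ⟫) τ} →
           lookupH h q ≡ just (injN true q₀) → MapTD ρ h P F Q₂ q₀ q₁ h₁ c →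
           MapTD ρ h P F (Q₁ ⊞ Q₂) q (length h₁) (injN true q₁ ∷ h₁) (suc c)
  mp-pair : ∀ {Γ τ ρ h h₁ h₂ P Q₁ Q₂ q a b a' b' c₁ c₂} {F : Fn Γ (P ⟪ τ ⟫) τ} →
            lookupH h q ≡ just (pairN a b) →
            MapTD ρ h P F Q₁ a a' h₁ c₁ → MapTD ρ h₁ P F Q₂ b b' h₂ c₂ →
            MapTD ρ h P F (Q₁ ⊠ Q₂) q (length h₂) (pairN a' b' ∷ h₂) (suc (c₁ + c₂))

data FoldDP where
  fd-hit  : ∀ {Γ τ ρ m h P p r} {F : Fn Γ (P ⟪ τ ⟫) τ} →
            lookupM m p ≡ just r → FoldDP ρ m h P F p r m h 1
  fd-miss : ∀ {Γ τ ρ m m₁ h h₁ h₂ P p q q' r c₁ c₂} {F : Fn Γ (P ⟪ τ ⟫) τ} →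
            lookupM m p ≡ nothing → lookupH h p ≡ just (conN P q) →
            MapDP ρ m h P F P q q' m₁ h₁ c₁ → Apply DP ρ h₁ F q' r h₂ c₂ →
            FoldDP ρ m h P F p r ((p , r) ∷ m₁) h₂ (suc (c₁ + c₂))

data MapDP where
  mq-id : ∀ {Γ τ ρ m m₁ h h₁ P q r c} {F : Fn Γ (P ⟪ τ ⟫) τ} →
          FoldDP ρ m h P F q r m₁ h₁ c → MapDP ρ m h P F Id q r m₁ h₁ (suc c)
  mq-k  : ∀ {Γ τ ρ m h P σ q} {F : Fn Γ (P ⟪ τ ⟫) τ} →
          MapDP ρ m h P F (K σ) q q m h 1
  mq-inl : ∀ {Γ τ ρ m m₁ h h₁ P Q₁ Q₂ q q₀ q₁ c} {F : Fn Γ (P ⟪ τ ⟫) τ} →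
           lookupH h q ≡ just (injN false q₀) → MapDP ρ m h P F Q₁ q₀ q₁ m₁ h₁ c →
           MapDP ρ m h P F (Q₁ ⊞ Q₂) q (length h₁) m₁ (injN false q₁ ∷ h₁) (suc c)
  mq-inr : ∀ {Γ τ ρ m m₁ h h₁ P Q₁ Q₂ q q₀ q₁ c} {F : Fn Γ (P ⟪ τ ⟫) τ} →
           lookupH h q ≡ just (injN true q₀) → MapDP ρ m h P F Q₂ q₀ q₁ m₁ h₁ c →
           MapDP ρ m h P F (Q₁ ⊞ Q₂) q (length h₁) m₁ (injN true q₁ ∷ h₁) (suc c)
  mq-pair : ∀ {Γ τ ρ m m₁ m₂ h h₁ h₂ P Q₁ Q₂ q a b a' b' c₁ c₂} {F : Fn Γ (P ⟪ τ ⟫) τ} →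
            lookupH h q ≡ just (pairN a b) →
            MapDP ρ m h P F Q₁ a a' m₁ h₁ c₁ → MapDP ρ m₁ h₁ P F Q₂ b b' m₂ h₂ c₂ →
            MapDP ρ m h P F (Q₁ ⊠ Q₂) q (length h₂) m₂ (pairN a' b' ∷ h₂) (suc (c₁ + c₂))

applyX₁ : ∀ {γ₁ γ₀} → Fn [] γ₁ γ₀ → Tm (γ₁ ∷ []) γ₀
applyX₁ f = app (renF there f) (var here)

-- polynomials with natural coefficients (c₀ ∷ c₁ ∷ …), Horner evaluation
NPoly : Set
NPoly = List ℕ

evalN : NPoly → ℕ → ℕ
evalN []       x = 0
evalN (a ∷ as) x = a + x * evalN as x

-- θ = {x₁ ↦ p} where p is a type-γ₁ value (dag) stored in heap h
PolyCost : Mode → ∀ {γ₁ γ₀} → Fn [] γ₁ γ₀ → Set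
PolyCost X {γ₁} f =
  Σ NPoly λ q → ∀ (h : Heap) (p : ℕ) → WFHeap h → HasTy h p γ₁ →
    ∀ (r : ℕ) (h' : Heap) (c : ℕ) → Eval X (p ∷ []) h (applyX₁ f) r h' c →
    c ≤ evalN q (size h p)

module Submission where

open import Defs
open import Data.Nat using (ℕ; zero; suc; _+_; _≤_; _<_; z≤n; s≤s; _≡ᵇ_)
open import Data.Nat.Properties
open import Data.Bool using (Bool; true; false; T)
open import Data.Bool.Properties using (T-∨)
open import Data.List using (List; []; _∷_; _++_; length; map; concatMap)
open import Data.Nat.ListAction using (sum)
open import Data.Nat.ListAction.Properties using (sum-++)
open import Data.List.Properties using (++-assoc; ++-identityʳ; length-++-≤ʳ; ++-cancelʳ; map-++)
open import Data.List.Membership.Propositional using (_∈_)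
open import Data.List.Membership.Propositional.Properties using (∈-++⁺ˡ; ∈-++⁺ʳ; ∈-++⁻)
open import Data.List.Relation.Binary.Subset.Propositional using (_⊆_)
open import Data.List.Relation.Binary.Subset.Propositional.Properties using (xs⊆xs++ys; xs⊆ys++xs; ++⁺ʳ)
open import Data.List.Relation.Unary.All as All using (All; []; _∷_)
open import Data.List.Relation.Unary.All.Properties using (concat⁺; map⁺)
open import Data.List.Relation.Unary.Any using (here; there)
open import Data.Maybe using (just)
open import Data.Maybe.Properties using (just-injective)
open import Data.Product using (_×_; _,_; proj₂; ∃-syntax)
open import Data.Sum as Sum using (_⊎_; inj₁; inj₂; [_,_]′)
open import Data.Unit using (⊤; tt)
open import Function using (_∘_; id)
open import Function.Bundles using (Equivalence)
open import Relation.Binary.Construct.Closure.ReflexiveTransitive using (Star; ε; _◅_; _◅◅_)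
open import Relation.Binary.PropositionalEquality
open import Relation.Nullary using (¬_; yes; no; contradiction)
open import Relation.Nullary.Reflects using (Reflects; ofʸ; ofⁿ; fromEquivalence)

-- (a) Every derivation node allocates at most one vertex, and every vertex reachable from the result is
-- either new or was reachable from the argument; so size(result) ≤ size(argument) + cost.
-- (b) A DP run is simulated by a TD run whose values unfold to the same trees, a memo hit (cost 1)
-- being replaced by recomputing the fold top-down (cost ≥ 1); hence TD cost bounds DP cost.
-- (c) With sequential folds the memo is never hit, so a TD derivation is a DP derivation of equal cost.

≡ᵇ-reflects : ∀ i j → Reflects (i ≡ j) (i ≡ᵇ j)
≡ᵇ-reflects i j = fromEquivalence (≡ᵇ⇒≡ i j) (≡⇒≡ᵇ i j)

mem-reflects : ∀ i js → Reflects (i ∈ js) (mem i js)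
mem-reflects i js = fromEquivalence (mem⇒∈ js) (∈⇒mem js)
  where
  mem⇒∈ : ∀ js → T (mem i js) → i ∈ js
  mem⇒∈ (j ∷ js) t with Equivalence.to T-∨ t
  ... | inj₁ i≡j = here (≡ᵇ⇒≡ i j i≡j)
  ... | inj₂ t′  = there (mem⇒∈ js t′)
  ∈⇒mem : ∀ js → i ∈ js → T (mem i js)
  ∈⇒mem (j ∷ js) (here refl)  = Equivalence.from T-∨ (inj₁ (≡⇒≡ᵇ i i refl))
  ∈⇒mem (j ∷ js) (there i∈js) = Equivalence.from T-∨ (inj₂ (∈⇒mem js i∈js))

-- Heaps

lookupH-head : ∀ n h → lookupH (n ∷ h) (length h) ≡ just n
lookupH-head n h with length h ≡ᵇ length h | ≡ᵇ-reflects (length h) (length h)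
... | true  | _      = refl
... | false | ofⁿ ≢ = contradiction refl ≢

lookupH-∷-≢ : ∀ n h {a} → a ≢ length h → lookupH (n ∷ h) a ≡ lookupH h a
lookupH-∷-≢ n h {a} a≢ with a ≡ᵇ length h | ≡ᵇ-reflects a (length h)
... | true  | ofʸ a≡ = contradiction a≡ a≢
... | false | _      = refl

lookupH-∷⁻ : ∀ {m h a n} → lookupH (m ∷ h) a ≡ just n → (a ≡ length h × m ≡ n) ⊎ lookupH h a ≡ just n
lookupH-∷⁻ {m} {h} {a} e with a ≡ᵇ length h | ≡ᵇ-reflects a (length h)
... | true  | ofʸ a≡ = inj₁ (a≡ , just-injective e)
... | false | _      = inj₂ e

lookupH-just⇒< : ∀ h {a n} → lookupH h a ≡ just n → a < length h
lookupH-just⇒< (m ∷ h) e with lookupH-∷⁻ {m} {h} e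
... | inj₁ (refl , _) = n<1+n (length h)
... | inj₂ e′         = m<n⇒m<1+n (lookupH-just⇒< h e′)

lookupH-∷⁺ : ∀ m h {a n} → lookupH h a ≡ just n → lookupH (m ∷ h) a ≡ just n
lookupH-∷⁺ m h e = trans (lookupH-∷-≢ m h (<⇒≢ (lookupH-just⇒< h e))) e

lookupH-++⁻ : ∀ N {h a n} → lookupH (N ++ h) a ≡ just n → n ∈ N ⊎ lookupH h a ≡ just n
lookupH-++⁻ []      e = inj₂ e
lookupH-++⁻ (m ∷ N) {h} e with lookupH-∷⁻ {m} {N ++ h} e
... | inj₁ (_ , refl) = inj₁ (here refl)
... | inj₂ e′         = Sum.map₁ there (lookupH-++⁻ N e′)

WFHeap-child< : ∀ h {a n c} → WFHeap h → lookupH h a ≡ just n → c ∈ children n → c < length h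
WFHeap-child< (m ∷ h) (m↓ , w) e c∈ with lookupH-∷⁻ {m} {h} e
... | inj₁ (_ , refl) = m<n⇒m<1+n (All.lookup m↓ c∈)
... | inj₂ e′         = m<n⇒m<1+n (WFHeap-child< h w e′ c∈)

_⊑_ : Heap → Heap → Set
h ⊑ h′ = ∃[ N ] h′ ≡ N ++ h

⊑-refl : ∀ {h} → h ⊑ h
⊑-refl = [] , refl

⊑-trans : ∀ {h h₁ h₂} → h ⊑ h₁ → h₁ ⊑ h₂ → h ⊑ h₂
⊑-trans (N₁ , refl) (N₂ , refl) = N₂ ++ N₁ , sym (++-assoc N₂ N₁ _)

⊑-∷ : ∀ {h h′} n → h ⊑ h′ → h ⊑ (n ∷ h′)
⊑-∷ n (N , refl) = n ∷ N , refl

lookupH-⊑ : ∀ {h h′ a n} → h ⊑ h′ → lookupH h a ≡ just n → lookupH h′ a ≡ just n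
lookupH-⊑ ([]    , refl) e = e
lookupH-⊑ (m ∷ N , refl) e = lookupH-∷⁺ m (N ++ _) (lookupH-⊑ (N , refl) e)

conCount : List Node → ℕ
conCount N = sum (map isCon N)

conCount-++ : ∀ N M → conCount (N ++ M) ≡ conCount N + conCount M
conCount-++ N M = trans (cong sum (map-++ isCon N M)) (sum-++ (map isCon N) (map isCon M))

isCon≤1 : ∀ n → isCon n ≤ 1
isCon≤1 unitN       = z≤n
isCon≤1 (injN _ _)  = z≤n
isCon≤1 (pairN _ _) = z≤n
isCon≤1 (conN _ _)  = s≤s z≤n

Allocates : ℕ → Heap → Heap → Set
Allocates c h h′ = ∃[ N ] h′ ≡ N ++ h × conCount N ≤ c

allocates-refl : ∀ {h c} → Allocates c h h
allocates-refl = [] , refl , z≤n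

allocates-push : ∀ {c h h′} n → Allocates c h h′ → Allocates (suc c) h (n ∷ h′)
allocates-push n (N , refl , k) = n ∷ N , refl , +-mono-≤ (isCon≤1 n) k

allocates-suc : ∀ {c h h′} → Allocates c h h′ → Allocates (suc c) h h′
allocates-suc (N , eq , k) = N , eq , m≤n⇒m≤1+n k

allocates-trans : ∀ {c₁ c₂ h h₁ h₂} → Allocates c₁ h h₁ → Allocates c₂ h₁ h₂ → Allocates (c₁ + c₂) h h₂
allocates-trans {c₁} {c₂} (N₁ , refl , k₁) (N₂ , refl , k₂) =
  N₂ ++ N₁ , sym (++-assoc N₂ N₁ _) ,
  (begin
    conCount (N₂ ++ N₁)       ≡⟨ conCount-++ N₂ N₁ ⟩
    conCount N₂ + conCount N₁ ≤⟨ +-mono-≤ k₂ k₁ ⟩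
    c₂ + c₁                   ≡⟨ +-comm c₂ c₁ ⟩
    c₁ + c₂                   ∎)
  where open ≤-Reasoning

allocates⇒⊑ : ∀ {c h h′} → Allocates c h h′ → h ⊑ h′
allocates⇒⊑ (N , eq , _) = N , eq

eval-allocates : ∀ {X Γ τ ρ h r h′ c} {e : Tm Γ τ} → Eval X ρ h e r h′ c → Allocates c h h′
apply-allocates : ∀ {X Γ σ τ ρ h p r h′ c} {F : Fn Γ σ τ} → Apply X ρ h F p r h′ c → Allocates c h h′
foldTD-allocates : ∀ {Γ τ ρ h P p r h′ c} {F : Fn Γ (P ⟪ τ ⟫) τ} → FoldTD ρ h P F p r h′ c → Allocates c h h′
mapTD-allocates : ∀ {Γ τ ρ h P Q q q′ h′ c} {F : Fn Γ (P ⟪ τ ⟫) τ} → MapTD ρ h P F Q q q′ h′ c → Allocates c h h′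
foldDP-allocates : ∀ {Γ τ ρ m h P p r m′ h′ c} {F : Fn Γ (P ⟪ τ ⟫) τ} →
  FoldDP ρ m h P F p r m′ h′ c → Allocates c h h′
mapDP-allocates : ∀ {Γ τ ρ m h P Q q q′ m′ h′ c} {F : Fn Γ (P ⟪ τ ⟫) τ} →
  MapDP ρ m h P F Q q q′ m′ h′ c → Allocates c h h′

eval-allocates ev-var              = allocates-refl
eval-allocates ev-tt               = allocates-push unitN allocates-refl
eval-allocates (ev-pair d₁ d₂)     = allocates-push _ (allocates-trans (eval-allocates d₁) (eval-allocates d₂))
eval-allocates (ev-fst d _)        = allocates-suc (eval-allocates d)
eval-allocates (ev-snd d _)        = allocates-suc (eval-allocates d)
eval-allocates (ev-inl d)          = allocates-push _ (eval-allocates d)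
eval-allocates (ev-inr d)          = allocates-push _ (eval-allocates d)
eval-allocates (ev-case₁ d _ d₁)   = allocates-suc (allocates-trans (eval-allocates d) (eval-allocates d₁))
eval-allocates (ev-case₂ d _ d₂)   = allocates-suc (allocates-trans (eval-allocates d) (eval-allocates d₂))
eval-allocates (ev-con d)          = allocates-push _ (eval-allocates d)
eval-allocates (ev-des d _)        = allocates-suc (eval-allocates d)
eval-allocates (ev-app d a)        = allocates-suc (allocates-trans (eval-allocates d) (apply-allocates a))
eval-allocates (ev-foldTD d f)     = allocates-suc (allocates-trans (eval-allocates d) (foldTD-allocates f))
eval-allocates (ev-foldDP d f)     = allocates-suc (allocates-trans (eval-allocates d) (foldDP-allocates f))
apply-allocates (ap-lam d)         = allocates-suc (eval-allocates d)
foldTD-allocates (fd _ m a)        = allocates-suc (allocates-trans (mapTD-allocates m) (apply-allocates a))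
mapTD-allocates (mp-id f)          = allocates-suc (foldTD-allocates f)
mapTD-allocates mp-k               = allocates-refl
mapTD-allocates (mp-inl _ m)       = allocates-push _ (mapTD-allocates m)
mapTD-allocates (mp-inr _ m)       = allocates-push _ (mapTD-allocates m)
mapTD-allocates (mp-pair _ m₁ m₂)  = allocates-push _ (allocates-trans (mapTD-allocates m₁) (mapTD-allocates m₂))
foldDP-allocates (fd-hit _)        = allocates-refl
foldDP-allocates (fd-miss _ _ m a) = allocates-suc (allocates-trans (mapDP-allocates m) (apply-allocates a))
mapDP-allocates (mq-id f)          = allocates-suc (foldDP-allocates f)
mapDP-allocates mq-k               = allocates-refl
mapDP-allocates (mq-inl _ m)       = allocates-push _ (mapDP-allocates m)
mapDP-allocates (mq-inr _ m)       = allocates-push _ (mapDP-allocates m)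
mapDP-allocates (mq-pair _ m₁ m₂)  = allocates-push _ (allocates-trans (mapDP-allocates m₁) (mapDP-allocates m₂))

-- Reachability and size

Edge : Heap → ℕ → ℕ → Set
Edge h a c = ∃[ n ] lookupH h a ≡ just n × c ∈ children n

Reach : Heap → ℕ → ℕ → Set
Reach h = Star (Edge h)

reach-≡⊎< : ∀ {h b a} → WFHeap h → Reach h b a → a ≡ b ⊎ a < length h
reach-≡⊎< w ε                   = inj₁ refl
reach-≡⊎< w ((_ , e , c∈) ◅ r) = inj₂ ([ (λ { refl → WFHeap-child< _ w e c∈ }) , id ]′ (reach-≡⊎< w r))

reach-∷⁻ : ∀ {n h b a} → WFHeap h → b ≢ length h → Reach (n ∷ h) b a → Reach h b a
reach-∷⁻ w b≢ ε = ε
reach-∷⁻ {n} {h} w b≢ ((m , e , c∈) ◅ r) = (m , e′ , c∈) ◅ reach-∷⁻ w (<⇒≢ (WFHeap-child< h w e′ c∈)) r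
  where e′ = trans (sym (lookupH-∷-≢ n h b≢)) e

reach-from-head : ∀ {n h a} → WFHeap (n ∷ h) → Reach (n ∷ h) (length h) a →
  a ≡ length h ⊎ ∃[ c ] c ∈ children n × Reach h c a
reach-from-head (n↓ , w) ε = inj₁ refl
reach-from-head {n} {h} (n↓ , w) ((m , e , c∈) ◅ r) with trans (sym (lookupH-head n h)) e
... | refl = inj₂ (_ , c∈ , reach-∷⁻ w (<⇒≢ (All.lookup n↓ c∈)) r)

head-unreachable : ∀ {n h b} → WFHeap h → b ≢ length h → ¬ Reach (n ∷ h) b (length h)
head-unreachable w b≢ r with reach-≡⊎< w (reach-∷⁻ w b≢ r)
... | inj₁ eq = b≢ (sym eq)
... | inj₂ lt = <-irrefl refl lt

Covered : Heap → List ℕ → List ℕ → Set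
Covered h ms ms′ = ∀ {a} → a ∈ ms → length h ≤ a ⊎ ∃[ b ] b ∈ ms′ × Reach h b a

covered-∷ : ∀ {n h ms ms′ ms″} → WFHeap (n ∷ h) → Covered (n ∷ h) ms ms′ →
  (length h ∈ ms′ → children n ⊆ ms″) → ms′ ⊆ ms″ → Covered h ms ms″
covered-∷ {h = h} w cov head⇒ ms′⊆ a∈ with cov a∈
... | inj₁ le = inj₁ (<⇒≤ le)
... | inj₂ (b , b∈ , r) with b ≟ length h
...   | no b≢ = inj₂ (b , ms′⊆ b∈ , reach-∷⁻ (proj₂ w) b≢ r)
...   | yes refl with reach-from-head w r
...     | inj₁ refl          = inj₁ ≤-refl
...     | inj₂ (c , c∈ , r′) = inj₂ (c , head⇒ b∈ c∈ , r′)

sizeM-mono : ∀ h {ms ms′} → WFHeap h → Covered h ms ms′ → sizeM ms h ≤ sizeM ms′ h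
sizeM-mono []      _ _ = z≤n
sizeM-mono (n ∷ h) {ms} {ms′} w cov
  with mem (length h) ms | mem-reflects (length h) ms | mem (length h) ms′ | mem-reflects (length h) ms′
... | true  | ofʸ _   | true  | ofʸ _ = +-monoʳ-≤ (isCon n) (sizeM-mono h (proj₂ w) cov′)
  where
  cov′ : Covered h (children n ++ ms) (children n ++ ms′)
  cov′ a∈ with ∈-++⁻ (children n) a∈
  ... | inj₁ a∈n  = inj₂ (_ , ∈-++⁺ˡ a∈n , ε)
  ... | inj₂ a∈ms = covered-∷ w cov (λ _ → xs⊆xs++ys _ _) (xs⊆ys++xs _ _) a∈ms
... | true  | ofʸ a∈ | false | ofⁿ a∉ with cov a∈
...   | inj₁ le            = contradiction le 1+n≰n
...   | inj₂ (b , b∈ , r) = contradiction r (head-unreachable (proj₂ w) (λ { refl → a∉ b∈ }))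
sizeM-mono (n ∷ h) w cov | false | _ | true  | _ =
  ≤-trans (sizeM-mono h (proj₂ w) (covered-∷ w cov (λ _ → xs⊆xs++ys _ _) (xs⊆ys++xs _ _))) (m≤n+m _ (isCon n))
sizeM-mono (n ∷ h) w cov | false | _ | false | ofⁿ a∉ =
  sizeM-mono h (proj₂ w) (covered-∷ w cov (λ a∈ → contradiction a∈ a∉) id)

sizeM-⊆ : ∀ h {ms ms′} → WFHeap h → ms ⊆ ms′ → sizeM ms h ≤ sizeM ms′ h
sizeM-⊆ h w ms⊆ = sizeM-mono h w (λ a∈ → inj₂ (_ , ms⊆ a∈ , ε))

sizeM-++ : ∀ N h ms → WFHeap h → sizeM ms (N ++ h) ≤ conCount N + sizeM (ms ++ concatMap children N) h
sizeM-++ []      h ms w = ≤-reflexive (cong (λ ms → sizeM ms h) (sym (++-identityʳ ms)))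
sizeM-++ (n ∷ N) h ms w with mem (length (N ++ h)) ms
... | true = begin
  isCon n + sizeM (children n ++ ms) (N ++ h)
    ≤⟨ +-monoʳ-≤ (isCon n) (sizeM-++ N h (children n ++ ms) w) ⟩
  isCon n + (conCount N + sizeM ((children n ++ ms) ++ concatMap children N) h)
    ≡⟨ +-assoc (isCon n) (conCount N) _ ⟨
  conCount (n ∷ N) + sizeM ((children n ++ ms) ++ concatMap children N) h
    ≤⟨ +-monoʳ-≤ (conCount (n ∷ N)) (sizeM-⊆ h w swap) ⟩
  conCount (n ∷ N) + sizeM (ms ++ concatMap children (n ∷ N)) h ∎
  where
  open ≤-Reasoning
  swap : (children n ++ ms) ++ concatMap children N ⊆ ms ++ (children n ++ concatMap children N)
  swap a∈ with ∈-++⁻ (children n ++ ms) a∈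
  ... | inj₂ a∈N = ∈-++⁺ʳ ms (∈-++⁺ʳ (children n) a∈N)
  ... | inj₁ a∈′ with ∈-++⁻ (children n) a∈′
  ...   | inj₁ a∈n  = ∈-++⁺ʳ ms (∈-++⁺ˡ a∈n)
  ...   | inj₂ a∈ms = ∈-++⁺ˡ a∈ms
... | false = ≤-trans (sizeM-++ N h ms w)
  (+-mono-≤ (m≤n+m (conCount N) (isCon n)) (sizeM-⊆ h w (++⁺ʳ ms (xs⊆ys++xs _ (children n)))))

module Rooted (h₀ : Heap) (p₀ : ℕ) where

  Rooted : ℕ → Set
  Rooted a = length h₀ ≤ a ⊎ Reach h₀ p₀ a

  RootedHeap : Heap → Set
  RootedHeap H = ∃[ N ] H ≡ N ++ h₀ × All (All Rooted ∘ children) N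

  allocate : ∀ {H} n → RootedHeap H → All Rooted (children n) → RootedHeap (n ∷ H) × Rooted (length H)
  allocate n (N , refl , N↓) n↓ = (n ∷ N , refl , n↓ ∷ N↓) , inj₁ (length-++-≤ʳ h₀ {N})

  children-rooted : ∀ {H a n} → RootedHeap H → Rooted a → lookupH H a ≡ just n → All Rooted (children n)
  children-rooted (N , refl , N↓) ra e with lookupH-++⁻ N e
  ... | inj₁ n∈N = All.lookup N↓ n∈N
  ... | inj₂ e₀ with ra
  ...   | inj₁ le = contradiction le (<⇒≱ (lookupH-just⇒< h₀ e₀))
  ...   | inj₂ r  = All.tabulate (λ c∈ → inj₂ (r ◅◅ ((_ , e₀ , c∈) ◅ ε)))

  EnvRooted : ∀ {Γ} → Env Γ → Set
  EnvRooted []      = ⊤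
  EnvRooted (p ∷ ρ) = Rooted p × EnvRooted ρ

  lookupE-rooted : ∀ {Γ τ} {ρ : Env Γ} → EnvRooted ρ → (x : Var Γ τ) → Rooted (lookupE ρ x)
  lookupE-rooted {ρ = _ ∷ _} (o , _) here      = o
  lookupE-rooted {ρ = _ ∷ _} (_ , E) (there x) = lookupE-rooted E x

  MemoRooted : Memo → Set
  MemoRooted m = ∀ i r → lookupM m i ≡ just r → Rooted r

  memoRooted-∷ : ∀ {m p r} → MemoRooted m → Rooted r → MemoRooted ((p , r) ∷ m)
  memoRooted-∷ {p = p} M o i r′ e with i ≡ᵇ p
  ... | true  = subst Rooted (just-injective e) o
  ... | false = M i r′ e

  eval-rooted : ∀ {X Γ τ ρ H r H′ c} {e : Tm Γ τ} → Eval X ρ H e r H′ c →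
    RootedHeap H → EnvRooted ρ → RootedHeap H′ × Rooted r
  apply-rooted : ∀ {X Γ σ τ ρ H p r H′ c} {F : Fn Γ σ τ} → Apply X ρ H F p r H′ c →
    RootedHeap H → EnvRooted ρ → Rooted p → RootedHeap H′ × Rooted r
  foldTD-rooted : ∀ {Γ τ ρ H P p r H′ c} {F : Fn Γ (P ⟪ τ ⟫) τ} → FoldTD ρ H P F p r H′ c →
    RootedHeap H → EnvRooted ρ → Rooted p → RootedHeap H′ × Rooted r
  mapTD-rooted : ∀ {Γ τ ρ H P Q q q′ H′ c} {F : Fn Γ (P ⟪ τ ⟫) τ} → MapTD ρ H P F Q q q′ H′ c →
    RootedHeap H → EnvRooted ρ → Rooted q → RootedHeap H′ × Rooted q′
  foldDP-rooted : ∀ {Γ τ ρ m H P p r m′ H′ c} {F : Fn Γ (P ⟪ τ ⟫) τ} → FoldDP ρ m H P F p r m′ H′ c →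
    RootedHeap H → EnvRooted ρ → MemoRooted m → Rooted p → RootedHeap H′ × Rooted r × MemoRooted m′
  mapDP-rooted : ∀ {Γ τ ρ m H P Q q q′ m′ H′ c} {F : Fn Γ (P ⟪ τ ⟫) τ} → MapDP ρ m H P F Q q q′ m′ H′ c →
    RootedHeap H → EnvRooted ρ → MemoRooted m → Rooted q → RootedHeap H′ × Rooted q′ × MemoRooted m′

  eval-rooted (ev-var {x = x}) I E = I , lookupE-rooted E x
  eval-rooted ev-tt I E = allocate unitN I []
  eval-rooted (ev-pair d₁ d₂) I E =
    let I₁ , o₁ = eval-rooted d₁ I E
        I₂ , o₂ = eval-rooted d₂ I₁ E
    in allocate _ I₂ (o₁ ∷ o₂ ∷ [])
  eval-rooted (ev-fst d e) I E =
    let I₁ , o = eval-rooted d I E in I₁ , All.head (children-rooted I₁ o e)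
  eval-rooted (ev-snd d e) I E =
    let I₁ , o = eval-rooted d I E in I₁ , All.head (All.tail (children-rooted I₁ o e))
  eval-rooted (ev-inl d) I E = let I₁ , o = eval-rooted d I E in allocate _ I₁ (o ∷ [])
  eval-rooted (ev-inr d) I E = let I₁ , o = eval-rooted d I E in allocate _ I₁ (o ∷ [])
  eval-rooted (ev-case₁ d e d₁) I E =
    let I₁ , o = eval-rooted d I E in eval-rooted d₁ I₁ (All.head (children-rooted I₁ o e) , E)
  eval-rooted (ev-case₂ d e d₂) I E =
    let I₁ , o = eval-rooted d I E in eval-rooted d₂ I₁ (All.head (children-rooted I₁ o e) , E)
  eval-rooted (ev-con d) I E = let I₁ , o = eval-rooted d I E in allocate _ I₁ (o ∷ [])
  eval-rooted (ev-des d e) I E =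
    let I₁ , o = eval-rooted d I E in I₁ , All.head (children-rooted I₁ o e)
  eval-rooted (ev-app d a) I E = let I₁ , o = eval-rooted d I E in apply-rooted a I₁ E o
  eval-rooted (ev-foldTD d f) I E = let I₁ , o = eval-rooted d I E in foldTD-rooted f I₁ E o
  eval-rooted (ev-foldDP d f) I E =
    let I₁ , o = eval-rooted d I E
        I₂ , o₂ , _ = foldDP-rooted f I₁ E (λ _ _ ()) o
    in I₂ , o₂

  apply-rooted (ap-lam d) I E o = eval-rooted d I (o , E)

  foldTD-rooted (fd e m a) I E o =
    let I₁ , o₁ = mapTD-rooted m I E (All.head (children-rooted I o e)) in apply-rooted a I₁ E o₁

  mapTD-rooted (mp-id f) I E o = foldTD-rooted f I E o
  mapTD-rooted mp-k I E o = I , o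
  mapTD-rooted (mp-inl e m) I E o =
    let I₁ , o₁ = mapTD-rooted m I E (All.head (children-rooted I o e)) in allocate _ I₁ (o₁ ∷ [])
  mapTD-rooted (mp-inr e m) I E o =
    let I₁ , o₁ = mapTD-rooted m I E (All.head (children-rooted I o e)) in allocate _ I₁ (o₁ ∷ [])
  mapTD-rooted (mp-pair e m₁ m₂) I E o =
    let I₁ , o₁ = mapTD-rooted m₁ I E (All.head (children-rooted I o e))
        I₂ , o₂ = mapTD-rooted m₂ I₁ E (All.head (All.tail (children-rooted I o e)))
    in allocate _ I₂ (o₁ ∷ o₂ ∷ [])

  foldDP-rooted (fd-hit e) I E M o = I , M _ _ e , M
  foldDP-rooted (fd-miss {m₁ = m₁} _ e m a) I E M o =
    let I₁ , o₁ , M₁ = mapDP-rooted m I E M (All.head (children-rooted I o e))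
        I₂ , o₂ = apply-rooted a I₁ E o₁
    in I₂ , o₂ , memoRooted-∷ {m₁} M₁ o₂

  mapDP-rooted (mq-id f) I E M o = foldDP-rooted f I E M o
  mapDP-rooted mq-k I E M o = I , o , M
  mapDP-rooted (mq-inl e m) I E M o =
    let I₁ , o₁ , M₁ = mapDP-rooted m I E M (All.head (children-rooted I o e))
        I₂ , o₂ = allocate _ I₁ (o₁ ∷ [])
    in I₂ , o₂ , M₁
  mapDP-rooted (mq-inr e m) I E M o =
    let I₁ , o₁ , M₁ = mapDP-rooted m I E M (All.head (children-rooted I o e))
        I₂ , o₂ = allocate _ I₁ (o₁ ∷ [])
    in I₂ , o₂ , M₁
  mapDP-rooted (mq-pair e m₁ m₂) I E M o =
    let I₁ , o₁ , M₁ = mapDP-rooted m₁ I E M (All.head (children-rooted I o e))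
        I₂ , o₂ , M₂ = mapDP-rooted m₂ I₁ E M₁ (All.head (All.tail (children-rooted I o e)))
        I₃ , o₃ = allocate _ I₂ (o₁ ∷ o₂ ∷ [])
    in I₃ , o₃ , M₂

  rooted⇒covered : ∀ {ms} → All Rooted ms → Covered h₀ ms (p₀ ∷ [])
  rooted⇒covered ms↓ a∈ = Sum.map₂ (λ r → p₀ , here refl , r) (All.lookup ms↓ a∈)

size-bound : ∀ {X σ τ h p r h′ c} {e : Tm (σ ∷ []) τ} → WFHeap h →
  Eval X (p ∷ []) h e r h′ c → size h′ r ≤ size h p + c
size-bound {h = h} {p} {r} {c = c} w d
  with Rooted.eval-rooted h p d ([] , refl , []) (inj₂ ε , tt) | eval-allocates d
... | (N , refl , N↓) , r↓ | (M , eq , k) with ++-cancelʳ h N M eq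
... | refl = begin
  sizeM (r ∷ []) (N ++ h)                                ≤⟨ sizeM-++ N h (r ∷ []) w ⟩
  conCount N + sizeM (r ∷ concatMap children N) h       ≤⟨ +-mono-≤ k (sizeM-mono h w (rooted⇒covered all↓)) ⟩
  c + size h p                                           ≡⟨ +-comm c (size h p) ⟩
  size h p + c                                           ∎
  where
  open ≤-Reasoning
  open Rooted h p
  all↓ : All Rooted (r ∷ concatMap children N)
  all↓ = r↓ ∷ concat⁺ (map⁺ N↓)

-- Simulating dynamic programming by top-down evaluation

data Tree : Set where
  unitT : Tree
  injT  : Bool → Tree → Tree
  pairT : Tree → Tree → Tree
  conT  : Poly → Tree → Tree

data Unfolds (h : Heap) (p : ℕ) (v : Tree) : Set
data UnfoldsNode (h : Heap) : Node → Tree → Set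

data Unfolds h p v where
  unfold : ∀ {n} → lookupH h p ≡ just n → UnfoldsNode h n v → Unfolds h p v

data UnfoldsNode h where
  unitU : UnfoldsNode h unitN unitT
  injU  : ∀ {b q v} → Unfolds h q v → UnfoldsNode h (injN b q) (injT b v)
  pairU : ∀ {a b u v} → Unfolds h a u → Unfolds h b v → UnfoldsNode h (pairN a b) (pairT u v)
  conU  : ∀ {P q v} → Unfolds h q v → UnfoldsNode h (conN P q) (conT P v)

unfolds-at : ∀ {h p v n} → Unfolds h p v → lookupH h p ≡ just n → UnfoldsNode h n v
unfolds-at (unfold e u) e′ with trans (sym e) e′
... | refl = u

unfolds-⊑ : ∀ {h h′ p v} → h ⊑ h′ → Unfolds h p v → Unfolds h′ p v
unfoldsNode-⊑ : ∀ {h h′ n v} → h ⊑ h′ → UnfoldsNode h n v → UnfoldsNode h′ n v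
unfolds-⊑ ext (unfold e u) = unfold (lookupH-⊑ ext e) (unfoldsNode-⊑ ext u)
unfoldsNode-⊑ ext unitU         = unitU
unfoldsNode-⊑ ext (injU d)      = injU (unfolds-⊑ ext d)
unfoldsNode-⊑ ext (pairU d₁ d₂) = pairU (unfolds-⊑ ext d₁) (unfolds-⊑ ext d₂)
unfoldsNode-⊑ ext (conU d)      = conU (unfolds-⊑ ext d)

unfolds-fresh : ∀ {h n v} → UnfoldsNode h n v → Unfolds (n ∷ h) (length h) v
unfolds-fresh {h} {n} u = unfold (lookupH-head n h) (unfoldsNode-⊑ (⊑-∷ n ⊑-refl) u)

unfolds-functional : ∀ {h p v w} → Unfolds h p v → Unfolds h p w → v ≡ w
unfoldsNode-functional : ∀ {h n v w} → UnfoldsNode h n v → UnfoldsNode h n w → v ≡ w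
unfolds-functional (unfold e u) d = unfoldsNode-functional u (unfolds-at d e)
unfoldsNode-functional unitU         unitU         = refl
unfoldsNode-functional (injU d)      (injU d′)     = cong (injT _) (unfolds-functional d d′)
unfoldsNode-functional (pairU d₁ d₂) (pairU d₁′ d₂′) =
  cong₂ pairT (unfolds-functional d₁ d₁′) (unfolds-functional d₂ d₂′)
unfoldsNode-functional (conU d)      (conU d′)     = cong (conT _) (unfolds-functional d d′)

HasTy⇒Unfolds : ∀ {h p τ} → HasTy h p τ → ∃[ v ] Unfolds h p v
HasTy⇒Unfolds (ty-unit e)       = _ , unfold e unitU
HasTy⇒Unfolds (ty-inl e t)      = _ , unfold e (injU (proj₂ (HasTy⇒Unfolds t)))
HasTy⇒Unfolds (ty-inr e t)      = _ , unfold e (injU (proj₂ (HasTy⇒Unfolds t)))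
HasTy⇒Unfolds (ty-pair e t₁ t₂) = _ , unfold e (pairU (proj₂ (HasTy⇒Unfolds t₁)) (proj₂ (HasTy⇒Unfolds t₂)))
HasTy⇒Unfolds (ty-con e t)      = _ , unfold e (conU (proj₂ (HasTy⇒Unfolds t)))

eval-⊑ : ∀ {X Γ τ ρ h r h′ c} {e : Tm Γ τ} → Eval X ρ h e r h′ c → h ⊑ h′
eval-⊑ = allocates⇒⊑ ∘ eval-allocates

apply-⊑ : ∀ {X Γ σ τ ρ h p r h′ c} {F : Fn Γ σ τ} → Apply X ρ h F p r h′ c → h ⊑ h′
apply-⊑ = allocates⇒⊑ ∘ apply-allocates

mapDP-⊑ : ∀ {Γ τ ρ m h P Q q q′ m′ h′ c} {F : Fn Γ (P ⟪ τ ⟫) τ} → MapDP ρ m h P F Q q q′ m′ h′ c → h ⊑ h′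
mapDP-⊑ = allocates⇒⊑ ∘ mapDP-allocates

data EnvSim (hD hT : Heap) : ∀ {Γ} → Env Γ → Env Γ → Set where
  []    : EnvSim hD hT [] []
  agree : ∀ {Γ τ pD pT} {ρD ρT : Env Γ} v → Unfolds hD pD v → Unfolds hT pT v →
          EnvSim hD hT ρD ρT → EnvSim hD hT (_∷_ {τ = τ} pD ρD) (pT ∷ ρT)

envSim-lookup : ∀ {hD hT Γ τ} {ρD ρT : Env Γ} → EnvSim hD hT ρD ρT → (x : Var Γ τ) →
  ∃[ v ] Unfolds hD (lookupE ρD x) v × Unfolds hT (lookupE ρT x) v
envSim-lookup (agree v dD dT _) here      = v , dD , dT
envSim-lookup (agree _ _ _ R)   (there x) = envSim-lookup R x

envSim-⊑ : ∀ {hD hD′ hT hT′ Γ} {ρD ρT : Env Γ} → hD ⊑ hD′ → hT ⊑ hT′ → EnvSim hD hT ρD ρT → EnvSim hD′ hT′ ρD ρT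
envSim-⊑ extD extT []                 = []
envSim-⊑ extD extT (agree v dD dT R) = agree v (unfolds-⊑ extD dD) (unfolds-⊑ extT dT) (envSim-⊑ extD extT R)

-- Quantified over extensions of hT because a memo entry is used by hits that occur later.
FoldsTo : ∀ {Γ τ} → Env Γ → (P : Poly) → Fn Γ (P ⟪ τ ⟫) τ → Heap → Tree → Tree → Set
FoldsTo ρT P F hT vi vo = ∀ {hT′ pT} → hT ⊑ hT′ → Unfolds hT′ pT vi →
  ∃[ rT ] ∃[ hT″ ] ∃[ cT ] FoldTD ρT hT′ P F pT rT hT″ cT × Unfolds hT″ rT vo × hT′ ⊑ hT″

record MemoSound {Γ τ} (ρT : Env Γ) (P : Poly) (F : Fn Γ (P ⟪ τ ⟫) τ) (m : Memo) (hD hT : Heap) : Set where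
  constructor memoSound
  field
    entry : ∀ pD rD → lookupM m pD ≡ just rD →
      ∃[ vi ] ∃[ vo ] Unfolds hD pD vi × Unfolds hD rD vo × FoldsTo ρT P F hT vi vo
open MemoSound

module _ {Γ τ} {ρT : Env Γ} {P : Poly} {F : Fn Γ (P ⟪ τ ⟫) τ} where

  memoSound-[] : ∀ {hD hT} → MemoSound ρT P F [] hD hT
  memoSound-[] = memoSound λ _ _ ()

  memoSound-⊑ : ∀ {m hD hD′ hT hT′} → hD ⊑ hD′ → hT ⊑ hT′ → MemoSound ρT P F m hD hT → MemoSound ρT P F m hD′ hT′
  memoSound-⊑ extD extT M = memoSound λ pD rD e →
    let vi , vo , dI , dO , k = entry M pD rD e
    in vi , vo , unfolds-⊑ extD dI , unfolds-⊑ extD dO , k ∘ ⊑-trans extT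

  memoSound-∷ : ∀ {m hD hT p r vi vo} → MemoSound ρT P F m hD hT →
    Unfolds hD p vi → Unfolds hD r vo → FoldsTo ρT P F hT vi vo → MemoSound ρT P F ((p , r) ∷ m) hD hT
  memoSound-∷ {m} {hD} {hT} {p} {r} {vi} {vo} M dI dO k = memoSound entry′
    where
    entry′ : ∀ pD rD → lookupM ((p , r) ∷ m) pD ≡ just rD →
      ∃[ vi ] ∃[ vo ] Unfolds hD pD vi × Unfolds hD rD vo × FoldsTo ρT P F hT vi vo
    entry′ pD rD e with pD ≡ᵇ p | ≡ᵇ-reflects pD p
    ... | true  | ofʸ refl rewrite just-injective e = vi , vo , dI , dO , k
    ... | false | _        = entry M pD rD e

foldTD-cost≥1 : ∀ {Γ τ ρ h P p r h′ c} {F : Fn Γ (P ⟪ τ ⟫) τ} → FoldTD ρ h P F p r h′ c → 1 ≤ c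
foldTD-cost≥1 (fd _ _ _) = s≤s z≤n

record Simulation (J : ℕ → Heap → ℕ → Set) (c : ℕ) (hD′ : Heap) (rD : ℕ) (hT : Heap) : Set where
  constructor sim
  field
    tree     : Tree
    rT       : ℕ
    hT′      : Heap
    cT       : ℕ
    run      : J rT hT′ cT
    cost≤    : c ≤ cT
    unfoldsD : Unfolds hD′ rD tree
    unfoldsT : Unfolds hT′ rT tree
    growsT   : hT ⊑ hT′

simulate-eval : ∀ {Γ τ ρ h r h′ c} {e : Tm Γ τ} → Eval DP ρ h e r h′ c →
  ∀ {ρT hT} → EnvSim h hT ρ ρT → Simulation (Eval TD ρT hT e) c h′ r hT
simulate-apply : ∀ {Γ σ τ ρ h p r h′ c} {F : Fn Γ σ τ} → Apply DP ρ h F p r h′ c →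
  ∀ {ρT hT pT v} → EnvSim h hT ρ ρT → Unfolds h p v → Unfolds hT pT v →
  Simulation (Apply TD ρT hT F pT) c h′ r hT
simulate-fold : ∀ {Γ τ ρ m h P p r m′ h′ c} {F : Fn Γ (P ⟪ τ ⟫) τ} → FoldDP ρ m h P F p r m′ h′ c →
  ∀ {ρT hT pT v} → EnvSim h hT ρ ρT → MemoSound ρT P F m h hT → Unfolds h p v → Unfolds hT pT v →
  Simulation (λ rT hT′ cT → FoldTD ρT hT P F pT rT hT′ cT × MemoSound ρT P F m′ h′ hT′) c h′ r hT
simulate-miss : ∀ {Γ τ ρ m m₁ h h₁ h₂ P q q′ r c₁ c₂} {F : Fn Γ (P ⟪ τ ⟫) τ} →
  MapDP ρ m h P F P q q′ m₁ h₁ c₁ → Apply DP ρ h₁ F q′ r h₂ c₂ →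
  ∀ {ρT hT pT qT v} → EnvSim h hT ρ ρT → MemoSound ρT P F m h hT →
  Unfolds h q v → lookupH hT pT ≡ just (conN P qT) → Unfolds hT qT v →
  Simulation (λ rT hT′ cT → FoldTD ρT hT P F pT rT hT′ cT × MemoSound ρT P F m₁ h₂ hT′) (suc (c₁ + c₂)) h₂ r hT
simulate-map : ∀ {Γ τ ρ m h P Q q q′ m′ h′ c} {F : Fn Γ (P ⟪ τ ⟫) τ} → MapDP ρ m h P F Q q q′ m′ h′ c →
  ∀ {ρT hT qT v} → EnvSim h hT ρ ρT → MemoSound ρT P F m h hT → Unfolds h q v → Unfolds hT qT v →
  Simulation (λ rT hT′ cT → MapTD ρT hT P F Q qT rT hT′ cT × MemoSound ρT P F m′ h′ hT′) c h′ q′ hT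

simulate-eval (ev-var {x = x}) R = let v , dD , dT = envSim-lookup R x in sim v _ _ 1 ev-var ≤-refl dD dT ⊑-refl
simulate-eval ev-tt R = sim unitT _ _ 1 ev-tt ≤-refl (unfolds-fresh unitU) (unfolds-fresh unitU) (⊑-∷ unitN ⊑-refl)
simulate-eval (ev-pair d₁ d₂) R =
  let sim v₁ _ _ _ t₁ l₁ dD₁ dT₁ x₁ = simulate-eval d₁ R
      sim v₂ _ _ _ t₂ l₂ dD₂ dT₂ x₂ = simulate-eval d₂ (envSim-⊑ (eval-⊑ d₁) x₁ R)
  in sim (pairT v₁ v₂) _ _ _ (ev-pair t₁ t₂) (s≤s (+-mono-≤ l₁ l₂))
       (unfolds-fresh (pairU (unfolds-⊑ (eval-⊑ d₂) dD₁) dD₂))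
       (unfolds-fresh (pairU (unfolds-⊑ x₂ dT₁) dT₂))
       (⊑-∷ _ (⊑-trans x₁ x₂))
simulate-eval (ev-fst d e) R with simulate-eval d R
... | sim _ _ _ _ t l dD dT x with unfolds-at dD e | dT
...   | pairU da _ | unfold eT (pairU daT _) = sim _ _ _ _ (ev-fst t eT) (s≤s l) da daT x
simulate-eval (ev-snd d e) R with simulate-eval d R
... | sim _ _ _ _ t l dD dT x with unfolds-at dD e | dT
...   | pairU _ db | unfold eT (pairU _ dbT) = sim _ _ _ _ (ev-snd t eT) (s≤s l) db dbT x
simulate-eval (ev-inl d) R =
  let sim v _ _ _ t l dD dT x = simulate-eval d R
  in sim (injT false v) _ _ _ (ev-inl t) (s≤s l) (unfolds-fresh (injU dD)) (unfolds-fresh (injU dT)) (⊑-∷ _ x)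
simulate-eval (ev-inr d) R =
  let sim v _ _ _ t l dD dT x = simulate-eval d R
  in sim (injT true v) _ _ _ (ev-inr t) (s≤s l) (unfolds-fresh (injU dD)) (unfolds-fresh (injU dT)) (⊑-∷ _ x)
simulate-eval (ev-case₁ d e d₁) R with simulate-eval d R
... | sim _ _ _ _ t l dD dT x with unfolds-at dD e | dT
...   | injU dq | unfold eT (injU dqT) =
  let sim v₁ _ _ _ t₁ l₁ dD₁ dT₁ x₁ = simulate-eval d₁ (agree _ dq dqT (envSim-⊑ (eval-⊑ d) x R))
  in sim v₁ _ _ _ (ev-case₁ t eT t₁) (s≤s (+-mono-≤ l l₁)) dD₁ dT₁ (⊑-trans x x₁)
simulate-eval (ev-case₂ d e d₂) R with simulate-eval d R
... | sim _ _ _ _ t l dD dT x with unfolds-at dD e | dT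
...   | injU dq | unfold eT (injU dqT) =
  let sim v₂ _ _ _ t₂ l₂ dD₂ dT₂ x₂ = simulate-eval d₂ (agree _ dq dqT (envSim-⊑ (eval-⊑ d) x R))
  in sim v₂ _ _ _ (ev-case₂ t eT t₂) (s≤s (+-mono-≤ l l₂)) dD₂ dT₂ (⊑-trans x x₂)
simulate-eval (ev-con d) R =
  let sim v _ _ _ t l dD dT x = simulate-eval d R
  in sim (conT _ v) _ _ _ (ev-con t) (s≤s l) (unfolds-fresh (conU dD)) (unfolds-fresh (conU dT)) (⊑-∷ _ x)
simulate-eval (ev-des d e) R with simulate-eval d R
... | sim _ _ _ _ t l dD dT x with unfolds-at dD e | dT
...   | conU dq | unfold eT (conU dqT) = sim _ _ _ _ (ev-des t eT) (s≤s l) dq dqT x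
simulate-eval (ev-app d a) R =
  let sim v _ _ _ t l dD dT x = simulate-eval d R
      sim v₁ _ _ _ t₁ l₁ dD₁ dT₁ x₁ = simulate-apply a (envSim-⊑ (eval-⊑ d) x R) dD dT
  in sim v₁ _ _ _ (ev-app t t₁) (s≤s (+-mono-≤ l l₁)) dD₁ dT₁ (⊑-trans x x₁)
simulate-eval (ev-foldDP d f) R =
  let sim v _ _ _ t l dD dT x = simulate-eval d R
      sim v₁ _ _ _ (t₁ , _) l₁ dD₁ dT₁ x₁ = simulate-fold f (envSim-⊑ (eval-⊑ d) x R) memoSound-[] dD dT
  in sim v₁ _ _ _ (ev-foldTD t t₁) (s≤s (+-mono-≤ l l₁)) dD₁ dT₁ (⊑-trans x x₁)

simulate-apply (ap-lam d) R dp dpT =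
  let sim v _ _ _ t l dD dT x = simulate-eval d (agree _ dp dpT R)
  in sim v _ _ _ (ap-lam t) (s≤s l) dD dT x

simulate-fold (fd-hit e) R M dp dpT with entry M _ _ e
... | _ , vo , dI , dO , refold with unfolds-functional dp dI
...   | refl =
  let rT , hT″ , cT , run , dOT , x = refold ⊑-refl dpT
  in sim vo rT hT″ cT (run , memoSound-⊑ ⊑-refl x M) (foldTD-cost≥1 run) dO dOT x
simulate-fold {ρ = ρ} {h = h} {P = P} {F = F} (fd-miss _ eq mp ap) {ρT} R M dp dpT
  with unfolds-at dp eq | dpT
... | conU {v = u} dq | unfold eT (conU dqT) with simulate-miss mp ap R M dq eT dqT
...   | sim vo _ hT₂ _ (run , M₂) le dO dOT x =
  sim vo _ _ _ (run , memoSound-∷ M₂ (unfolds-⊑ (⊑-trans (mapDP-⊑ mp) (apply-⊑ ap)) dp) dO refold) le dO dOT x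
  where
  refold : FoldsTo ρT P F hT₂ (conT P u) vo
  refold ext (unfold eT′ (conU dqT′))
    with simulate-miss mp ap (envSim-⊑ ⊑-refl (⊑-trans x ext) R) (memoSound-⊑ ⊑-refl (⊑-trans x ext) M) dq eT′ dqT′
  ... | sim _ _ _ _ (run′ , _) _ dO′ dOT′ x′ rewrite unfolds-functional dO dO′ = _ , _ , _ , run′ , dOT′ , x′

simulate-miss mp ap R M dq eT dqT =
  let sim w _ _ _ (mt , M₁) l₁ dw dwT x₁ = simulate-map mp R M dq dqT
      sim vo _ _ _ at l₂ dO dOT x₂ = simulate-apply ap (envSim-⊑ (mapDP-⊑ mp) x₁ R) dw dwT
  in sim vo _ _ _ (fd eT mt at , memoSound-⊑ (apply-⊑ ap) x₂ M₁) (s≤s (+-mono-≤ l₁ l₂)) dO dOT (⊑-trans x₁ x₂)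

simulate-map (mq-id f) R M dq dqT =
  let sim v _ _ _ (t , M′) l dD dT x = simulate-fold f R M dq dqT
  in sim v _ _ _ (mp-id t , M′) (s≤s l) dD dT x
simulate-map mq-k R M dq dqT = sim _ _ _ 1 (mp-k , M) ≤-refl dq dqT ⊑-refl
simulate-map (mq-inl e m) R M dq dqT with unfolds-at dq e | dqT
... | injU dq₀ | unfold eT (injU dqT₀) =
  let sim w _ _ _ (mt , M₁) l dw dwT x = simulate-map m R M dq₀ dqT₀
  in sim (injT false w) _ _ _ (mp-inl eT mt , memoSound-⊑ (⊑-∷ _ ⊑-refl) (⊑-∷ _ ⊑-refl) M₁) (s≤s l)
       (unfolds-fresh (injU dw)) (unfolds-fresh (injU dwT)) (⊑-∷ _ x)
simulate-map (mq-inr e m) R M dq dqT with unfolds-at dq e | dqT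
... | injU dq₀ | unfold eT (injU dqT₀) =
  let sim w _ _ _ (mt , M₁) l dw dwT x = simulate-map m R M dq₀ dqT₀
  in sim (injT true w) _ _ _ (mp-inr eT mt , memoSound-⊑ (⊑-∷ _ ⊑-refl) (⊑-∷ _ ⊑-refl) M₁) (s≤s l)
       (unfolds-fresh (injU dw)) (unfolds-fresh (injU dwT)) (⊑-∷ _ x)
simulate-map (mq-pair e m₁ m₂) R M dq dqT with unfolds-at dq e | dqT
... | pairU da db | unfold eT (pairU daT dbT) =
  let sim w₁ _ _ _ (mt₁ , M₁) l₁ dw₁ dwT₁ x₁ = simulate-map m₁ R M da daT
      sim w₂ _ _ _ (mt₂ , M₂) l₂ dw₂ dwT₂ x₂ =
        simulate-map m₂ (envSim-⊑ (mapDP-⊑ m₁) x₁ R) M₁ (unfolds-⊑ (mapDP-⊑ m₁) db) (unfolds-⊑ x₁ dbT)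
  in sim (pairT w₁ w₂) _ _ _ (mp-pair eT mt₁ mt₂ , memoSound-⊑ (⊑-∷ _ ⊑-refl) (⊑-∷ _ ⊑-refl) M₂)
       (s≤s (+-mono-≤ l₁ l₂))
       (unfolds-fresh (pairU (unfolds-⊑ (mapDP-⊑ m₂) dw₁) dw₂))
       (unfolds-fresh (pairU (unfolds-⊑ x₂ dwT₁) dwT₂))
       (⊑-∷ _ (⊑-trans x₁ x₂))

polyCost-TD⇒DP : ∀ {γ₁ γ₀} (f : Fn [] γ₁ γ₀) → PolyCost TD f → PolyCost DP f
polyCost-TD⇒DP f (q , bound) = q , λ h p w t r h′ c d →
  let v , dv = HasTy⇒Unfolds t
      sim _ rT hT′ cT run le _ _ _ = simulate-eval d (agree v dv dv [])
  in ≤-trans le (bound h p w t rT hT′ cT run)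

-- Sequential folds

seqFolds-ren : ∀ {Γ Δ τ} (ρ : Ren Γ Δ) (e : Tm Γ τ) → seqFolds e → seqFolds (ren ρ e)
seqFoldsF-ren : ∀ {Γ Δ σ τ} (ρ : Ren Γ Δ) (F : Fn Γ σ τ) → seqFoldsF F → seqFoldsF (renF ρ F)
seqFolds-ren ρ (var x)        s                = s
seqFolds-ren ρ tt             s                = s
seqFolds-ren ρ (pair a b)     (sa , sb)        = seqFolds-ren ρ a sa , seqFolds-ren ρ b sb
seqFolds-ren ρ (fst e)        s                = seqFolds-ren ρ e s
seqFolds-ren ρ (snd e)        s                = seqFolds-ren ρ e s
seqFolds-ren ρ (inl e)        s                = seqFolds-ren ρ e s
seqFolds-ren ρ (inr e)        s                = seqFolds-ren ρ e s
seqFolds-ren ρ (case e e₁ e₂) (s , s₁ , s₂)    =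
  seqFolds-ren ρ e s , seqFolds-ren (ext ρ) e₁ s₁ , seqFolds-ren (ext ρ) e₂ s₂
seqFolds-ren ρ (con P e)      s                = seqFolds-ren ρ e s
seqFolds-ren ρ (des P e)      s                = seqFolds-ren ρ e s
seqFolds-ren ρ (app F e)      (sF , se)        = seqFoldsF-ren ρ F sF , seqFolds-ren ρ e se
seqFolds-ren ρ (fold P F e)   (seqP , sF , se) = seqP , seqFoldsF-ren ρ F sF , seqFolds-ren ρ e se
seqFoldsF-ren ρ (lam e)       s                = seqFolds-ren (ext ρ) e s

m+n≤1⇒m≤0⊎n≤0 : ∀ m {n} → m + n ≤ 1 → m ≤ 0 ⊎ n ≤ 0
m+n≤1⇒m≤0⊎n≤0 zero    _         = inj₁ z≤n
m+n≤1⇒m≤0⊎n≤0 (suc m) (s≤s m+n≤0) = inj₂ (m+n≤o⇒n≤o m m+n≤0)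

-- For deg P ≤ 1 every vertex triggers at most one recursive fold, and it is started before anything
-- is memoised; so a top-down run is a DP run that always misses an empty memo.
td⇒dp : ∀ {Γ τ ρ h r h′ c} {e : Tm Γ τ} → seqFolds e → Eval TD ρ h e r h′ c → Eval DP ρ h e r h′ c
td⇒dp-apply : ∀ {Γ σ τ ρ h p r h′ c} {F : Fn Γ σ τ} → seqFoldsF F →
  Apply TD ρ h F p r h′ c → Apply DP ρ h F p r h′ c
td⇒dp-fold : ∀ {Γ τ ρ h P p r h′ c} {F : Fn Γ (P ⟪ τ ⟫) τ} → deg P ≤ 1 → seqFoldsF F →
  FoldTD ρ h P F p r h′ c → ∃[ m ] FoldDP ρ [] h P F p r m h′ c
td⇒dp-map : ∀ {Γ τ ρ h P Q q q′ h′ c} {F : Fn Γ (P ⟪ τ ⟫) τ} → deg P ≤ 1 → deg Q ≤ 1 → seqFoldsF F →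
  MapTD ρ h P F Q q q′ h′ c → ∃[ m ] MapDP ρ [] h P F Q q q′ m h′ c
td⇒dp-map₀ : ∀ {Γ τ ρ h P Q q q′ h′ c} {F : Fn Γ (P ⟪ τ ⟫) τ} → deg Q ≤ 0 →
  MapTD ρ h P F Q q q′ h′ c → ∀ m → MapDP ρ m h P F Q q q′ m h′ c

td⇒dp s                  ev-var              = ev-var
td⇒dp s                  ev-tt               = ev-tt
td⇒dp (sa , sb)          (ev-pair d₁ d₂)     = ev-pair (td⇒dp sa d₁) (td⇒dp sb d₂)
td⇒dp s                  (ev-fst d e)        = ev-fst (td⇒dp s d) e
td⇒dp s                  (ev-snd d e)        = ev-snd (td⇒dp s d) e
td⇒dp s                  (ev-inl d)          = ev-inl (td⇒dp s d)
td⇒dp s                  (ev-inr d)          = ev-inr (td⇒dp s d)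
td⇒dp (s , s₁ , _)       (ev-case₁ d e d₁)   = ev-case₁ (td⇒dp s d) e (td⇒dp s₁ d₁)
td⇒dp (s , _ , s₂)       (ev-case₂ d e d₂)   = ev-case₂ (td⇒dp s d) e (td⇒dp s₂ d₂)
td⇒dp s                  (ev-con d)          = ev-con (td⇒dp s d)
td⇒dp s                  (ev-des d e)        = ev-des (td⇒dp s d) e
td⇒dp (sF , se)          (ev-app d a)        = ev-app (td⇒dp se d) (td⇒dp-apply sF a)
td⇒dp (seqP , sF , se)   (ev-foldTD d f)     = ev-foldDP (td⇒dp se d) (proj₂ (td⇒dp-fold seqP sF f))

td⇒dp-apply s (ap-lam d) = ap-lam (td⇒dp s d)

td⇒dp-fold degP sF (fd e m a) = _ , fd-miss refl e (proj₂ (td⇒dp-map degP degP sF m)) (td⇒dp-apply sF a)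

td⇒dp-map degP degQ sF (mp-id f) = _ , mq-id (proj₂ (td⇒dp-fold degP sF f))
td⇒dp-map degP degQ sF mp-k      = _ , mq-k
td⇒dp-map {Q = Q₁ ⊞ Q₂} degP degQ sF (mp-inl e m) =
  _ , mq-inl e (proj₂ (td⇒dp-map degP (m⊔n≤o⇒m≤o (deg Q₁) (deg Q₂) degQ) sF m))
td⇒dp-map {Q = Q₁ ⊞ Q₂} degP degQ sF (mp-inr e m) =
  _ , mq-inr e (proj₂ (td⇒dp-map degP (m⊔n≤o⇒n≤o (deg Q₁) (deg Q₂) degQ) sF m))
td⇒dp-map {Q = Q₁ ⊠ Q₂} degP degQ sF (mp-pair e m₁ m₂) with m+n≤1⇒m≤0⊎n≤0 (deg Q₁) degQ
... | inj₁ deg₁≤0 = _ , mq-pair e (td⇒dp-map₀ deg₁≤0 m₁ []) (proj₂ (td⇒dp-map degP (m+n≤o⇒n≤o (deg Q₁) degQ) sF m₂))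
... | inj₂ deg₂≤0 = _ , mq-pair e (proj₂ (td⇒dp-map degP (m+n≤o⇒m≤o (deg Q₁) degQ) sF m₁)) (td⇒dp-map₀ deg₂≤0 m₂ _)

td⇒dp-map₀ () (mp-id _) _
td⇒dp-map₀ degQ mp-k m = mq-k
td⇒dp-map₀ {Q = Q₁ ⊞ Q₂} degQ (mp-inl e d) m = mq-inl e (td⇒dp-map₀ (m⊔n≤o⇒m≤o (deg Q₁) (deg Q₂) degQ) d m)
td⇒dp-map₀ {Q = Q₁ ⊞ Q₂} degQ (mp-inr e d) m = mq-inr e (td⇒dp-map₀ (m⊔n≤o⇒n≤o (deg Q₁) (deg Q₂) degQ) d m)
td⇒dp-map₀ {Q = Q₁ ⊠ Q₂} degQ (mp-pair e d₁ d₂) m =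
  mq-pair e (td⇒dp-map₀ (m+n≤o⇒m≤o (deg Q₁) degQ) d₁ m) (td⇒dp-map₀ (m+n≤o⇒n≤o (deg Q₁) degQ) d₂ m)

polyCost-DP⇒TD : ∀ {γ₁ γ₀} (f : Fn [] γ₁ γ₀) → PolyCost DP f → seqFoldsF f → PolyCost TD f
polyCost-DP⇒TD f (q , bound) s =
  q , λ h p w t r h′ c d → bound h p w t r h′ c (td⇒dp (seqFoldsF-ren there f s , tt) d)

lemma8 : ∀ {γ₁ γ₀} (f : Fn [] γ₁ γ₀) → wfFn f →
    (∀ (X : Mode) (h : Heap) (p : ℕ) → WFHeap h → HasTy h p γ₁ →
       ∀ (r : ℕ) (h' : Heap) (c : ℕ) → Eval X (p ∷ []) h (applyX₁ f) r h' c →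
       size h' r ≤ size h p + c)
    × (PolyCost TD f → PolyCost DP f)
    × (PolyCost DP f → seqFoldsF f → PolyCost TD f)
lemma8 f _ = (λ X h p w _ r h′ c → size-bound w) , polyCost-TD⇒DP f , polyCost-DP⇒TD f
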